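{- Let $\ell\ge3$ and let $n_1\ge\dots\ge n_\ell$ be positive even integers, and $T=S(n_1,\dots,n_\ell)$. Then $$\gamma_{\rm SMB}'(T)\le\max\bigl(\{i+\lceil\log_2 n_i\rceil: i\in[\ell-2]\}\cup\{\ell-2+\lceil\log_2(n_{\ell-1}+n_\ell+1)\rceil\}\bigr).$$ Moreover, the bound is sharp for every $\ell\ge3$: for every $\ell\ge3$ there exists such a $T$ attaining equality.
   Context: $S(n_1,\dots,n_\ell)$ is the subdivided star obtained from paths $P_{n_1},\dots,P_{n_\ell}$ and a new central vertex $x$ by making $x$ adjacent to one end of each path. The Maker-Breaker domination game on a finite simple graph $G$: Dominator and Staller alternately claim previously unclaimed vertices. Staller wins if she claims all vertices of the closed neighborhood $N_G[v]$ of some vertex $v$; otherwise Dominator wins. In the S-game Staller moves first. $\gamma_{\rm SMB}'(G)$ is the minimum number of moves Staller needs to win the S-game under optimal play (Staller minimizing, Dominator preventing or delaying), $\infty$ if she cannot win. $[m]=\{1,\dots,m\}$. -}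

module Defs where

open import Data.Nat using (ℕ; zero; suc; _+_; _∸_; _⊔_; _≤_; _<?_)
open import Data.Nat.Logarithm using (⌈log₂_⌉)
open import Data.Fin using (Fin; toℕ; fromℕ<)
open import Data.List using (List; map; foldr; upTo)
open import Data.Product using (Σ; _×_; _,_)
open import Data.Sum using (_⊎_)
open import Data.Empty using (⊥)
open import Relation.Nullary using (yes; no)
open import Relation.Binary.Definitions using (DecidableEquality)
open import Relation.Binary.PropositionalEquality using (_≡_; refl; cong)
import Data.Fin as F

-- Graphs (the vertex type carries decidable equality so that game
-- positions can be updated; Adj is the adjacency relation)

record Graph : Set₁ where
  field
    V    : Set
    _≟V_ : DecidableEquality V
    Adj  : V → V → Set

data Owner : Set where
  free dom sta : Owner

module Game (G : Graph) where
  open Graph G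

  Position : Set
  Position = V → Owner

  set : Position → V → Owner → Position
  set s v o u with u ≟V v
  ... | yes _ = o
  ... | no  _ = s u

  InN : V → V → Set
  InN v u = (u ≡ v) ⊎ Adj v u

  StallerWon : Position → Set
  StallerWon s = Σ V λ v → ∀ u → InN v u → s u ≡ sta

  -- SWin k s : with Staller to move in position s, Staller can force a
  -- win within (at most) k further moves of her own.
  -- After Staller's move, if she has not won and no vertex is free,
  -- the game is over and Dominator has won.
  SWin : ℕ → Position → Set
  SWin zero    s = ⊥
  SWin (suc k) s =
    Σ V λ v → (s v ≡ free) ×
      (StallerWon (set s v sta) ⊎
        ((Σ V λ w → set s v sta w ≡ free) ×
         (∀ w → set s v sta w ≡ free → SWin k (set (set s v sta) w dom))))

  start : Position
  start _ = free

γSMB'≤ : Graph → ℕ → Set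
γSMB'≤ G k = Game.SWin G k (Game.start G)

γSMB'≡ : Graph → ℕ → Set
γSMB'≡ G k = γSMB'≤ G k × (∀ m → γSMB'≤ G m → k ≤ m)

-- Subdivided star S(n_1,…,n_ℓ); leg i (0-indexed) is the path P_{n i}
-- with vertices leg i 0, …, leg i (n i - 1); leg i 0 is adjacent to x.

module Star (ℓ : ℕ) (n : Fin ℓ → ℕ) where

  data SV : Set where
    center : SV
    leg    : (i : Fin ℓ) → Fin (n i) → SV

  data SAdj : SV → SV → Set where
    c-l  : ∀ i (j : Fin (n i)) → toℕ j ≡ 0 → SAdj center (leg i j)
    l-c  : ∀ i (j : Fin (n i)) → toℕ j ≡ 0 → SAdj (leg i j) center
    l-l⁺ : ∀ i (j j′ : Fin (n i)) → suc (toℕ j) ≡ toℕ j′ → SAdj (leg i j) (leg i j′)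
    l-l⁻ : ∀ i (j j′ : Fin (n i)) → toℕ j ≡ suc (toℕ j′) → SAdj (leg i j) (leg i j′)

  _≟SV_ : DecidableEquality SV
  center ≟SV center = yes refl
  center ≟SV leg _ _ = no λ ()
  leg _ _ ≟SV center = no λ ()
  leg i j ≟SV leg i′ j′ with i F.≟ i′
  ... | no i≢ = no λ { refl → i≢ refl }
  ... | yes refl with j F.≟ j′
  ...   | yes refl = yes refl
  ...   | no j≢ = no λ { refl → j≢ refl }

  graph : Graph
  graph = record { V = SV ; _≟V_ = _≟SV_ ; Adj = SAdj }

S : (ℓ : ℕ) → (Fin ℓ → ℕ) → Graph
S ℓ n = Star.graph ℓ n

-- The bound.  at ℓ n i = n_{i+1} (paper indexing), 0 if out of range.

at : (ℓ : ℕ) → (Fin ℓ → ℕ) → ℕ → ℕ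
at ℓ n i with i <? ℓ
... | yes p = n (fromℕ< p)
... | no  _ = 0

bound : (ℓ : ℕ) → (Fin ℓ → ℕ) → ℕ
bound ℓ n =
  foldr _⊔_ ((ℓ ∸ 2) + ⌈log₂ (at ℓ n (ℓ ∸ 2) + at ℓ n (ℓ ∸ 1) + 1) ⌉)
    (map (λ i → suc i + ⌈log₂ (at ℓ n i) ⌉) (upTo (ℓ ∸ 2)))

Admissible : (ℓ : ℕ) → (Fin ℓ → ℕ) → Set
Admissible ℓ n =
  (∀ i → 1 ≤ n i) × (∀ i → Σ ℕ λ k → n i ≡ k + k) ×
  (∀ i j → toℕ i ≤ toℕ j → n j ≤ n i)

{-# OPTIONS --safe #-}
module Submission where

-- Staller claims, one after the other, the roots (the neighbours of x) of the
-- legs P_{n_1}, …, P_{n_{ℓ-2}}.  If Dominator answers off the leg just rooted,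
-- the rest of that leg is a free path of odd length n_i - 1 whose closed
-- neighbourhoods lie in the path or are Staller's; on such a path of length
-- 2m + 1 Staller claims the middle vertex and continues in the half Dominator
-- did not touch, winning in 1 + ⌈log₂ (m + 1)⌉ moves, here ⌈log₂ n_i⌉.  If
-- Dominator always answers on the leg, after ℓ - 2 rounds the last two legs
-- and x form such a path, of length n_{ℓ-1} + n_ℓ + 1.
-- For sharpness take every n_i = 2: Dominator answers each claim on a leg with
-- the other vertex of that leg, so Staller can only fill N[x], which needs
-- ℓ + 1 moves, and the bound is at most ℓ + 1.

open import Defs
open import Data.Nat
open import Data.Nat.Properties
open import Data.Nat.Induction using (<-wellFounded)
open import Data.Nat.Logarithm using (⌈log₂_⌉; ⌈log₂⌉-mono-≤)
open import Data.Nat.Logarithm.Core using (⌈log2⌉-acc-irrelevant)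
open import Data.Nat.Tactic.RingSolver using (solve-∀)
open import Data.Fin using (Fin; toℕ; fromℕ<)
import Data.Fin as Fin
import Data.Fin.Properties as Fin
open import Data.Fin.Properties using (toℕ-fromℕ<; fromℕ<-toℕ; fromℕ<-cong; toℕ<n; toℕ-injective)
open import Data.List using (map; upTo)
open import Data.List.Properties using (foldr-preservesʳ; foldr-preservesᵇ; foldr-forcesᵇ)
open import Data.List.Relation.Unary.All.Properties using (map⁺; map⁻; applyUpTo⁺₁; applyUpTo⁻)
open import Function using (id; _∘_)
open import Data.Product using (Σ; ∃; ∃₂; _×_; _,_; proj₁; proj₂)
open import Data.Sum using (_⊎_; inj₁; inj₂)
open import Data.Empty using (⊥; ⊥-elim)
open import Induction.WellFounded using (Acc; acc)
open import Relation.Nullary using (Dec; yes; no; ¬_)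
open import Relation.Nullary.Decidable using (_×-dec_)
open import Relation.Nullary.Negation using (contradiction)
open import Relation.Binary.Definitions using (tri<; tri≈; tri>)
open import Relation.Binary.PropositionalEquality

⌈log₂[2+n]⌉≡1+⌈log₂[1+⌈n/2⌉]⌉ : ∀ n → ⌈log₂ (2 + n) ⌉ ≡ suc ⌈log₂ (suc ⌈ n /2⌉) ⌉
⌈log₂[2+n]⌉≡1+⌈log₂[1+⌈n/2⌉]⌉ n with <-wellFounded (2 + n)
... | acc _ = cong suc (⌈log2⌉-acc-irrelevant (suc ⌈ n /2⌉))

n≤2^⌈log₂n⌉ : ∀ n → n ≤ 2 ^ ⌈log₂ n ⌉
n≤2^⌈log₂n⌉ n = go n (<-wellFounded n)
  where
  go : ∀ n → Acc _<_ n → n ≤ 2 ^ ⌈log₂ n ⌉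
  go 0 _ = z≤n
  go 1 _ = s≤s z≤n
  go (suc (suc k)) (acc rec) = begin
    2 + k                                ≤⟨ +-monoʳ-≤ 2 k≤⌈k/2⌉+⌈k/2⌉ ⟩
    2 + (⌈ k /2⌉ + ⌈ k /2⌉)              ≡⟨ cong suc (sym (+-suc ⌈ k /2⌉ ⌈ k /2⌉)) ⟩
    h + h                                ≤⟨ +-mono-≤ (go h (rec (⌈n/2⌉<n k))) (go h (rec (⌈n/2⌉<n k))) ⟩
    2 ^ ⌈log₂ h ⌉ + 2 ^ ⌈log₂ h ⌉       ≡⟨ cong (2 ^ ⌈log₂ h ⌉ +_) (sym (+-identityʳ _)) ⟩
    2 ^ suc ⌈log₂ h ⌉                    ≡⟨ cong (2 ^_) (sym (⌈log₂[2+n]⌉≡1+⌈log₂[1+⌈n/2⌉]⌉ k)) ⟩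
    2 ^ ⌈log₂ (2 + k) ⌉                  ∎
    where
    open ≤-Reasoning
    h = suc ⌈ k /2⌉
    k≤⌈k/2⌉+⌈k/2⌉ : k ≤ ⌈ k /2⌉ + ⌈ k /2⌉
    k≤⌈k/2⌉+⌈k/2⌉ = subst (_≤ ⌈ k /2⌉ + ⌈ k /2⌉) (⌊n/2⌋+⌈n/2⌉≡n k)
                      (+-monoˡ-≤ ⌈ k /2⌉ (⌊n/2⌋≤⌈n/2⌉ k))

⌈log₂[2+2n]⌉≡1+⌈log₂[1+n]⌉ : ∀ n → ⌈log₂ (2 + (n + n)) ⌉ ≡ suc ⌈log₂ (suc n) ⌉
⌈log₂[2+2n]⌉≡1+⌈log₂[1+n]⌉ n =
  trans (⌈log₂[2+n]⌉≡1+⌈log₂[1+⌈n/2⌉]⌉ (n + n)) (cong (λ h → suc ⌈log₂ (suc h) ⌉) (sym (n≡⌈n+n/2⌉ n)))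

⌈log₂[3+2n]⌉≡1+⌈log₂[2+n]⌉ : ∀ n → ⌈log₂ (suc (suc n + suc n)) ⌉ ≡ suc ⌈log₂ (2 + n) ⌉
⌈log₂[3+2n]⌉≡1+⌈log₂[2+n]⌉ n = begin
  ⌈log₂ (suc (suc n + suc n)) ⌉      ≡⟨ cong (λ h → ⌈log₂ (2 + h) ⌉) (+-suc n n) ⟩
  ⌈log₂ (2 + suc (n + n)) ⌉          ≡⟨ ⌈log₂[2+n]⌉≡1+⌈log₂[1+⌈n/2⌉]⌉ (suc (n + n)) ⟩
  suc ⌈log₂ (2 + ⌊ n + n /2⌋) ⌉      ≡⟨ cong (λ h → suc ⌈log₂ (2 + h) ⌉) (sym (n≡⌊n+n/2⌋ n)) ⟩
  suc ⌈log₂ (2 + n) ⌉                ∎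
  where open ≡-Reasoning

≤⇒1+≢ : ∀ {m n} → m ≤ n → ¬ suc n ≡ m
≤⇒1+≢ m≤n refl = 1+n≰n m≤n

m+n≤o+m⇒n≤o : ∀ m {n o} → m + n ≤ o + m → n ≤ o
m+n≤o+m⇒n≤o m {n} {o} m+n≤o+m = +-cancelˡ-≤ m n o (subst (m + n ≤_) (+-comm o m) m+n≤o+m)

suc[m∸1+n]≡m∸n : ∀ {m n} → n < m → suc (m ∸ suc n) ≡ m ∸ n
suc[m∸1+n]≡m∸n n<m = sym (+-∸-assoc 1 n<m)

m∸1+[m∸1+n]≡n : ∀ {m n} → n < m → m ∸ suc (m ∸ suc n) ≡ n
m∸1+[m∸1+n]≡n {suc m} (s≤s n≤m) = m∸[m∸n]≡n n≤m

m∸1+n<m : ∀ {m n} → n < m → m ∸ suc n < m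
m∸1+n<m {m} {n} n<m = subst (_≤ m) (sym (suc[m∸1+n]≡m∸n n<m)) (m∸n≤m m n)

split-<-double : ∀ p m → suc m < p + p → ∃₂ λ m₁ m₂ → m₁ < p × m₂ < p × m₁ + m₂ ≡ m
split-<-double (suc q) m 1+m<p+p with m ≤? q
... | yes m≤q = m , 0 , s≤s m≤q , s≤s z≤n , +-identityʳ m
... | no m≰q = q , m ∸ q , ≤-refl , s≤s (m≤n+o⇒m∸n≤o m q m≤q+q) , m+[n∸m]≡n (<⇒≤ (≰⇒> m≰q))
  where
  m≤q+q : m ≤ q + q
  m≤q+q = ≤-pred (≤-pred (subst (suc (suc m) ≤_) (cong suc (+-suc q q)) 1+m<p+p))

halves-length : ∀ lo m₁ m₂ →
  lo + suc (suc (m₁ + m₂) + suc (m₁ + m₂)) ≡ suc (lo + suc (m₁ + m₁)) + suc (m₂ + m₂)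
halves-length = solve-∀

two-legs-length : ∀ a b → 2 + (a + a) + (2 + (b + b)) + 1 ≡ suc (suc (suc (a + b)) + suc (suc (a + b)))
two-legs-length = solve-∀

positive-even : ∀ {m} → 1 ≤ m → (∃ λ k → m ≡ k + k) → ∃ λ c → m ≡ 2 + (c + c)
positive-even 1≤m (zero , refl) = contradiction 1≤m λ ()
positive-even _ (suc c , m≡) = c , trans m≡ (cong suc (+-suc c c))

legTerm : (ℓ : ℕ) → (Fin ℓ → ℕ) → ℕ → ℕ
legTerm ℓ n i = suc i + ⌈log₂ (at ℓ n i) ⌉

pathTerm : (ℓ : ℕ) → (Fin ℓ → ℕ) → ℕ
pathTerm ℓ n = (ℓ ∸ 2) + ⌈log₂ (at ℓ n (ℓ ∸ 2) + at ℓ n (ℓ ∸ 1) + 1) ⌉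

pathTerm≤bound : ∀ ℓ n → pathTerm ℓ n ≤ bound ℓ n
pathTerm≤bound ℓ n =
  foldr-preservesʳ {P = pathTerm ℓ n ≤_} {f = _⊔_} (λ x → m≤n⇒m≤o⊔n x) ≤-refl (map (legTerm ℓ n) (upTo (ℓ ∸ 2)))

legTerm≤bound : ∀ ℓ n {i} → i < ℓ ∸ 2 → legTerm ℓ n i ≤ bound ℓ n
legTerm≤bound ℓ n = applyUpTo⁻ id (ℓ ∸ 2) (map⁻ (foldr-forcesᵇ {P = _≤ bound ℓ n} {f = _⊔_}
  (λ x y x⊔y≤b → m⊔n≤o⇒m≤o x y x⊔y≤b , m⊔n≤o⇒n≤o x y x⊔y≤b) (pathTerm ℓ n) _ ≤-refl))

bound≤ : ∀ ℓ n {c} → pathTerm ℓ n ≤ c → (∀ {i} → i < ℓ ∸ 2 → legTerm ℓ n i ≤ c) → bound ℓ n ≤ c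
bound≤ ℓ n {c} path≤c legs≤c =
  foldr-preservesᵇ {P = _≤ c} {f = _⊔_} ⊔-lub path≤c (map⁺ (applyUpTo⁺₁ id (ℓ ∸ 2) legs≤c))

at-toℕ : ∀ ℓ (n : Fin ℓ → ℕ) j → at ℓ n (toℕ j) ≡ n j
at-toℕ ℓ n j with toℕ j <? ℓ
... | yes j<ℓ = cong n (fromℕ<-toℕ j j<ℓ)
... | no j≮ℓ = contradiction (toℕ<n j) j≮ℓ

at-const≤ : ∀ ℓ c i → at ℓ (λ _ → c) i ≤ c
at-const≤ ℓ c i with i <? ℓ
... | yes _ = ≤-refl
... | no _ = z≤n

free≢sta : ¬ free ≡ sta
free≢sta ()

isFree? : ∀ o → Dec (o ≡ free)
isFree? free = yes refl
isFree? sta = no λ ()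
isFree? dom = no λ ()

dom≢sta : ¬ dom ≡ sta
dom≢sta ()

free≢dom : ¬ free ≡ dom
free≢dom ()

module GameProperties (G : Graph) where
  open Graph G
  open Game G

  set-≡ : ∀ s v o → set s v o v ≡ o
  set-≡ s v o with v ≟V v
  ... | yes _ = refl
  ... | no v≢v = contradiction refl v≢v

  set-≢ : ∀ s v o {u} → ¬ u ≡ v → set s v o u ≡ s u
  set-≢ s v o {u} u≢v with u ≟V v
  ... | yes u≡v = contradiction u≡v u≢v
  ... | no _ = refl

  set-sta-keeps-sta : ∀ s v {u} → s u ≡ sta → set s v sta u ≡ sta
  set-sta-keeps-sta s v {u} su≡sta with u ≟V v
  ... | yes _ = refl
  ... | no _ = su≡sta

  set-dom-keeps-sta : ∀ s {w u} → s w ≡ free → s u ≡ sta → set s w dom u ≡ sta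
  set-dom-keeps-sta s {w} {u} sw≡free su≡sta with u ≟V w
  ... | yes refl = ⊥-elim (free≢sta (trans (sym sw≡free) su≡sta))
  ... | no _ = su≡sta

  round-≢ : ∀ s v w {x} → ¬ x ≡ v → ¬ x ≡ w → set (set s v sta) w dom x ≡ s x
  round-≢ s v w x≢v x≢w = trans (set-≢ (set s v sta) w dom x≢w) (set-≢ s v sta x≢v)

  round-keeps-sta : ∀ s v {w x} → set s v sta w ≡ free → s x ≡ sta → set (set s v sta) w dom x ≡ sta
  round-keeps-sta s v free-w sx≡sta = set-dom-keeps-sta (set s v sta) free-w (set-sta-keeps-sta s v sx≡sta)

  round-claims : ∀ s v {w} → set s v sta w ≡ free → set (set s v sta) w dom v ≡ sta
  round-claims s v free-w = set-dom-keeps-sta (set s v sta) free-w (set-≡ s v sta)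

  set-dom-keeps-dom : ∀ s w {x} → s x ≡ dom → set s w dom x ≡ dom
  set-dom-keeps-dom s w {x} sx≡dom with x ≟V w
  ... | yes _ = refl
  ... | no _ = sx≡dom

  set-sta-origin : ∀ s v {x} → set s v sta x ≡ sta → s x ≡ sta ⊎ x ≡ v
  set-sta-origin s v {x} s₁x≡sta with x ≟V v
  ... | yes x≡v = inj₂ x≡v
  ... | no _ = inj₁ s₁x≡sta

  set-dom-sta-origin : ∀ s w {x} → set s w dom x ≡ sta → s x ≡ sta
  set-dom-sta-origin s w {x} s₁x≡sta with x ≟V w
  ... | yes _ = ⊥-elim (dom≢sta s₁x≡sta)
  ... | no _ = s₁x≡sta

  SWin-mono : ∀ {k k′} s → k ≤ k′ → SWin k s → SWin k′ s
  SWin-mono s (s≤s k≤k′) (v , free-v , inj₁ won) = v , free-v , inj₁ won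
  SWin-mono s (s≤s k≤k′) (v , free-v , inj₂ (some-free , respond)) =
    v , free-v , inj₂ (some-free , λ w free-w → SWin-mono _ k≤k′ (respond w free-w))

  -- A segment is a path u lo, …, u (hi - 1) of free vertices whose closed
  -- neighbourhoods lie inside the path or are already Staller's.
  Near : Position → ℕ → ℕ → (ℕ → V) → ℕ → V → Set
  Near s lo hi u i w =
    s w ≡ sta ⊎ w ≡ u i ⊎ (suc i < hi × w ≡ u (suc i)) ⊎ (∃ λ j → lo ≤ j × suc j ≡ i × w ≡ u j)

  record Segment (s : Position) (lo hi : ℕ) (u : ℕ → V) : Set where
    field
      unclaimed : ∀ {i} → lo ≤ i → i < hi → s (u i) ≡ free
      injective : ∀ {i j} → lo ≤ i → i < hi → lo ≤ j → j < hi → u i ≡ u j → i ≡ j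
      closed    : ∀ {i} → lo ≤ i → i < hi → ∀ {w} → InN (u i) w → Near s lo hi u i w
  open Segment

  Segment-shrink : ∀ {s s′ lo hi lo′ hi′ u} → Segment s lo hi u → lo ≤ lo′ → hi′ ≤ hi →
                   (∀ {x} → s x ≡ sta → s′ x ≡ sta) →
                   (∀ {i} → lo′ ≤ i → i < hi′ → s′ (u i) ≡ s (u i)) →
                   (∀ {j} → lo ≤ j → suc j ≡ lo′ → s′ (u j) ≡ sta) →
                   (hi′ < hi → s′ (u hi′) ≡ sta) →
                   Segment s′ lo′ hi′ u
  Segment-shrink {s} {s′} {lo} {hi} {lo′} {hi′} {u} seg lo≤lo′ hi′≤hi keep same below above = record
    { unclaimed = λ l h → trans (same l h) (unclaimed seg (widen-lo l) (widen-hi h))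
    ; injective = λ li hi lj hj → injective seg (widen-lo li) (widen-hi hi) (widen-lo lj) (widen-hi hj)
    ; closed    = λ l h w∈N → near l h (closed seg (widen-lo l) (widen-hi h) w∈N)
    }
    where
    widen-lo : ∀ {i} → lo′ ≤ i → lo ≤ i
    widen-lo = ≤-trans lo≤lo′
    widen-hi : ∀ {i} → i < hi′ → i < hi
    widen-hi i<hi′ = <-≤-trans i<hi′ hi′≤hi
    claimed : ∀ {w x} → w ≡ u x → s′ (u x) ≡ sta → s′ w ≡ sta
    claimed refl = λ p → p
    near : ∀ {i w} → lo′ ≤ i → i < hi′ → Near s lo hi u i w → Near s′ lo′ hi′ u i w
    near _ _ (inj₁ sw≡sta) = inj₁ (keep sw≡sta)
    near _ _ (inj₂ (inj₁ w≡ui)) = inj₂ (inj₁ w≡ui)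
    near {i} _ i<hi′ (inj₂ (inj₂ (inj₁ (1+i<hi , w≡u1+i)))) with suc i <? hi′
    ... | yes 1+i<hi′ = inj₂ (inj₂ (inj₁ (1+i<hi′ , w≡u1+i)))
    ... | no 1+i≮hi′ with ≤-antisym i<hi′ (≮⇒≥ 1+i≮hi′)
    ...   | refl = inj₁ (claimed w≡u1+i (above 1+i<hi))
    near {i} lo′≤i _ (inj₂ (inj₂ (inj₂ (j , lo≤j , 1+j≡i , w≡uj)))) with lo′ ≤? j
    ... | yes lo′≤j = inj₂ (inj₂ (inj₂ (j , lo′≤j , 1+j≡i , w≡uj)))
    ... | no lo′≰j =
      inj₁ (claimed w≡uj (below lo≤j (≤-antisym (≰⇒> lo′≰j) (subst (lo′ ≤_) (sym 1+j≡i) lo′≤i))))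

  Segment-claim-left : ∀ {s lo hi u a} → Segment s lo hi u → lo ≤ a → a < hi →
                       Segment (set s (u a) sta) lo a u
  Segment-claim-left {s} {u = u} {a} seg lo≤a a<hi =
    Segment-shrink seg ≤-refl (<⇒≤ a<hi) (set-sta-keeps-sta s (u a))
      (λ l i<a → set-≢ s (u a) sta (λ ui≡ua → <⇒≢ i<a (injective seg l (<-trans i<a a<hi) lo≤a a<hi ui≡ua)))
      (λ lo≤j 1+j≡lo → contradiction 1+j≡lo (≤⇒1+≢ lo≤j))
      (λ _ → set-≡ s (u a) sta)

  Segment-claim-right : ∀ {s lo hi u a} → Segment s lo hi u → lo ≤ a → a < hi →
                        Segment (set s (u a) sta) (suc a) hi u
  Segment-claim-right {s} {u = u} {a} seg lo≤a a<hi =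
    Segment-shrink seg (≤-trans lo≤a (n≤1+n a)) ≤-refl (set-sta-keeps-sta s (u a))
      (λ a<i i<hi → set-≢ s (u a) sta
        (λ ui≡ua → >⇒≢ a<i (injective seg (≤-trans lo≤a (<⇒≤ a<i)) i<hi lo≤a a<hi ui≡ua)))
      (λ { _ refl → set-≡ s (u a) sta })
      (λ hi<hi → contradiction hi<hi (<-irrefl refl))

  Segment-dom : ∀ {s lo hi u w} → Segment s lo hi u → s w ≡ free →
                (∀ {i} → lo ≤ i → i < hi → ¬ u i ≡ w) → Segment (set s w dom) lo hi u
  Segment-dom {s} {w = w} seg sw≡free avoids =
    Segment-shrink seg ≤-refl ≤-refl (set-dom-keeps-sta s sw≡free)
      (λ l h → set-≢ s w dom (avoids l h))
      (λ lo≤j 1+j≡lo → contradiction 1+j≡lo (≤⇒1+≢ lo≤j))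
      (λ hi<hi → contradiction hi<hi (<-irrefl refl))

  Segment-win₁ : ∀ {s lo u} t → Segment s lo (suc lo) u → SWin (suc t) s
  Segment-win₁ {s} {lo} {u} t seg =
    u lo , unclaimed seg ≤-refl ≤-refl , inj₁ (u lo , λ w w∈N → claimed (closed seg ≤-refl ≤-refl w∈N))
    where
    claimed : ∀ {w} → Near s lo (suc lo) u lo w → set s (u lo) sta w ≡ sta
    claimed (inj₁ sw≡sta) = set-sta-keeps-sta s (u lo) sw≡sta
    claimed (inj₂ (inj₁ refl)) = set-≡ s (u lo) sta
    claimed (inj₂ (inj₂ (inj₁ (1+lo<1+lo , _)))) = contradiction 1+lo<1+lo (<-irrefl refl)
    claimed (inj₂ (inj₂ (inj₂ (j , lo≤j , 1+j≡lo , _)))) = contradiction 1+j≡lo (≤⇒1+≢ lo≤j)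

  -- Staller claims the middle vertex and then plays in whichever half
  -- Dominator did not answer in.
  Segment-win : ∀ t m {s lo u} → m < 2 ^ t → Segment s lo (lo + suc (m + m)) u → SWin (suc t) s
  Segment-win t zero {s} {lo} {u} _ seg = Segment-win₁ t (subst (λ hi → Segment s lo hi u) (+-comm lo 1) seg)
  Segment-win zero (suc m) (s≤s ())
  Segment-win (suc t) (suc m) {s} {lo} {u} 1+m<2^[1+t] seg
    with split-<-double (2 ^ t) m (subst (suc (suc m) ≤_) (cong (2 ^ t +_) (+-identityʳ (2 ^ t))) 1+m<2^[1+t])
  ... | m₁ , m₂ , m₁<2^t , m₂<2^t , refl =
    u a , unclaimed seg′ lo≤a a<hi , inj₂ ((u lo , free-lo) , respond)
    where
    a = lo + suc (m₁ + m₁)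
    hi = suc a + suc (m₂ + m₂)
    lo≤a : lo ≤ a
    lo≤a = m≤m+n lo _
    a<hi : a < hi
    a<hi = s≤s (m≤m+n a _)
    seg′ : Segment s lo hi u
    seg′ = subst (λ h → Segment s lo h u) (halves-length lo m₁ m₂) seg
    lo<a : lo < a
    lo<a = m<m+n lo z<s
    free-lo : set s (u a) sta (u lo) ≡ free
    free-lo = trans (set-≢ s (u a) sta (<⇒≢ lo<a ∘ injective seg′ ≤-refl (<-trans lo<a a<hi) lo≤a a<hi))
                    (unclaimed seg′ ≤-refl (<-trans lo<a a<hi))
    respond : ∀ w → set s (u a) sta w ≡ free → SWin (suc t) (set (set s (u a) sta) w dom)
    respond w free-w with anyUpTo? (λ j → (lo ≤? j) ×-dec (u j ≟V w)) a
    ... | yes (j , j<a , lo≤j , uj≡w) =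
      Segment-win t m₂ m₂<2^t (Segment-dom (Segment-claim-right seg′ lo≤a a<hi) free-w
        (λ a<i i<hi ui≡w → >⇒≢ (<-trans j<a a<i)
          (injective seg′ (≤-trans lo≤a (<⇒≤ a<i)) i<hi lo≤j (<-trans j<a a<hi) (trans ui≡w (sym uj≡w)))))
    ... | no w∉left =
      Segment-win t m₁ m₁<2^t (Segment-dom (Segment-claim-left seg′ lo≤a a<hi) free-w
        (λ lo≤i i<a ui≡w → w∉left (_ , i<a , lo≤i , ui≡w)))

  Segment-win-log : ∀ m {s lo u} → Segment s lo (lo + suc (m + m)) u → SWin (suc ⌈log₂ (suc m) ⌉) s
  Segment-win-log m = Segment-win _ m (n≤2^⌈log₂n⌉ (suc m))

-- Staller's strategy on S(n₁, …, n_ℓ)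

module UpperBound (ℓ′ : ℕ) (n : Fin (3 + ℓ′) → ℕ) (half : ∀ j → ∃ λ c → n j ≡ 2 + (c + c)) where
  open Star (3 + ℓ′) n
  open Game (S (3 + ℓ′) n)
  open GameProperties (S (3 + ℓ′) n)
  open Segment

  leg-injective : ∀ {j} {q q′ : Fin (n j)} → leg j q ≡ leg j q′ → q ≡ q′
  leg-injective refl = refl

  leg-≢ : ∀ {j j′} {q : Fin (n j)} {q′ : Fin (n j′)} → ¬ toℕ j ≡ toℕ j′ → ¬ leg j q ≡ leg j′ q′
  leg-≢ j≢j′ refl = j≢j′ refl

  on-leg? : ∀ j w → (∃ λ q → w ≡ leg j q) ⊎ (∀ q → ¬ w ≡ leg j q)
  on-leg? j center = inj₂ λ _ ()
  on-leg? j (leg j′ q) with j′ Fin.≟ j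
  ... | yes refl = inj₁ (q , refl)
  ... | no j′≢j = inj₂ λ { _ refl → j′≢j refl }

  legVertex : Fin (3 + ℓ′) → ℕ → SV
  legVertex j q with q <? n j
  ... | yes q<n = leg j (fromℕ< q<n)
  ... | no _ = center

  legVertex-fromℕ< : ∀ j {q} (q<n : q < n j) → legVertex j q ≡ leg j (fromℕ< q<n)
  legVertex-fromℕ< j {q} q<n with q <? n j
  ... | yes q<n′ = cong (leg j) (fromℕ<-cong q q refl q<n′ q<n)
  ... | no q≮n = contradiction q<n q≮n

  legVertex-toℕ : ∀ j f → legVertex j (toℕ f) ≡ leg j f
  legVertex-toℕ j f = trans (legVertex-fromℕ< j (toℕ<n f)) (cong (leg j) (fromℕ<-toℕ f (toℕ<n f)))

  legVertex-view : ∀ j {i} → i < n j → ∃ λ f → toℕ f ≡ i × legVertex j i ≡ leg j f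
  legVertex-view j i<n = fromℕ< i<n , toℕ-fromℕ< i<n , legVertex-fromℕ< j i<n

  leg-segment : ∀ {s} j → (∀ q → toℕ q ≡ 0 → s (leg j q) ≡ sta) → (∀ q → 1 ≤ toℕ q → s (leg j q) ≡ free) →
                Segment s 1 (n j) (legVertex j)
  leg-segment {s} j root-sta rest-free = record { unclaimed = unclaimed′ ; injective = injective′ ; closed = closed′ }
    where
    unclaimed′ : ∀ {i} → 1 ≤ i → i < n j → s (legVertex j i) ≡ free
    unclaimed′ 1≤i i<n with legVertex-view j i<n
    ... | f , refl , eq = trans (cong s eq) (rest-free f 1≤i)

    injective′ : ∀ {i i′} → 1 ≤ i → i < n j → 1 ≤ i′ → i′ < n j → legVertex j i ≡ legVertex j i′ → i ≡ i′
    injective′ _ i<n _ i′<n e with legVertex-view j i<n | legVertex-view j i′<n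
    ... | f , refl , eq | f′ , refl , eq′ = cong toℕ (leg-injective (trans (sym eq) (trans e eq′)))

    near : ∀ f {w} → 1 ≤ toℕ f → InN (leg j f) w → Near s 1 (n j) (legVertex j) (toℕ f) w
    near f _ (inj₁ refl) = inj₂ (inj₁ (sym (legVertex-toℕ j f)))
    near f 1≤f (inj₂ (l-c _ _ f≡0)) = contradiction (subst (1 ≤_) f≡0 1≤f) λ ()
    near f _ (inj₂ (l-l⁺ _ _ f′ 1+f≡f′)) =
      inj₂ (inj₂ (inj₁ (subst (_< n j) (sym 1+f≡f′) (toℕ<n f′) ,
                        sym (trans (cong (legVertex j) 1+f≡f′) (legVertex-toℕ j f′)))))
    near f _ (inj₂ (l-l⁻ _ _ f′ f≡1+f′)) with 1 ≤? toℕ f′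
    ... | yes 1≤f′ = inj₂ (inj₂ (inj₂ (toℕ f′ , 1≤f′ , sym f≡1+f′ , sym (legVertex-toℕ j f′))))
    ... | no 1≰f′ = inj₁ (root-sta f′ (n<1⇒n≡0 (≰⇒> 1≰f′)))

    closed′ : ∀ {i} → 1 ≤ i → i < n j → ∀ {w} → InN (legVertex j i) w → Near s 1 (n j) (legVertex j) i w
    closed′ 1≤i i<n {w} w∈N with legVertex-view j i<n
    ... | f , refl , eq = near f 1≤i (subst (λ v → InN v w) eq w∈N)

  record Progress (i : ℕ) (s : Position) : Set where
    field
      center-free : s center ≡ free
      legs-free   : ∀ j q → i ≤ toℕ j → s (leg j q) ≡ free
      roots-sta   : ∀ j q → toℕ j < i → toℕ q ≡ 0 → s (leg j q) ≡ sta
  open Progress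

  claim-root : ∀ {i k s} j → toℕ j ≡ i → Progress i s → ⌈log₂ (n j) ⌉ ≤ k →
               (∀ {s′} → Progress (suc i) s′ → SWin k s′) → SWin (suc k) s
  claim-root {i} {k} {s} j refl prog log≤k continue =
    root , legs-free prog j r₀ ≤-refl , inj₂ ((leg j r₁ , free-r₁) , respond)
    where
    c = proj₁ (half j)
    n≡2+2c : n j ≡ 2 + (c + c)
    n≡2+2c = proj₂ (half j)
    1<n : 1 < n j
    1<n = subst (1 <_) (sym n≡2+2c) (s≤s (s≤s z≤n))
    r₀ r₁ : Fin (n j)
    r₀ = fromℕ< (<-trans z<s 1<n)
    r₁ = fromℕ< 1<n
    root = leg j r₀
    is-root : ∀ {q} → toℕ q ≡ 0 → q ≡ r₀
    is-root q≡0 = toℕ-injective (trans q≡0 (sym (toℕ-fromℕ< (<-trans z<s 1<n))))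
    not-root : ∀ {q} → 1 ≤ toℕ q → ¬ leg j q ≡ root
    not-root 1≤q e = contradiction (subst (1 ≤_) (trans (cong toℕ (leg-injective e)) (toℕ-fromℕ< (<-trans z<s 1<n))) 1≤q) λ ()
    free-r₁ : set s root sta (leg j r₁) ≡ free
    free-r₁ = trans (set-≢ s root sta (not-root (≤-reflexive (sym (toℕ-fromℕ< 1<n))))) (legs-free prog j r₁ ≤-refl)
    respond : ∀ w → set s root sta w ≡ free → SWin k (set (set s root sta) w dom)
    respond w free-w with on-leg? j w
    ... | inj₁ (q , refl) = continue (record
      { center-free = trans (round-≢ s root w (λ ()) (λ ())) (center-free prog)
      ; legs-free = λ j′ q′ 1+i≤j′ → let j′≢j = <⇒≢ 1+i≤j′ ∘ sym in
          trans (round-≢ s root w (leg-≢ j′≢j) (leg-≢ j′≢j)) (legs-free prog j′ q′ (<⇒≤ 1+i≤j′))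
      ; roots-sta = earlier-roots
      })
      where
      earlier-roots : ∀ j′ q′ → toℕ j′ < suc (toℕ j) → toℕ q′ ≡ 0 →
                      set (set s root sta) w dom (leg j′ q′) ≡ sta
      earlier-roots j′ q′ j′<1+j q′≡0 with m≤n⇒m<n∨m≡n (≤-pred j′<1+j)
      ... | inj₁ j′<j = round-keeps-sta s root {w} free-w (roots-sta prog j′ q′ j′<j q′≡0)
      ... | inj₂ j′≡j with toℕ-injective j′≡j
      ...   | refl rewrite is-root q′≡0 = round-claims s root {w} free-w
    ... | inj₂ w∉leg =
      SWin-mono _ (subst (_≤ k) (trans (cong ⌈log₂_⌉ n≡2+2c) (⌈log₂[2+2n]⌉≡1+⌈log₂[1+n]⌉ c)) log≤k)
        (Segment-win-log c (subst (λ h → Segment s₂ 1 h (legVertex j)) n≡2+2c (leg-segment j root-sta′ rest-free′)))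
      where
      s₂ = set (set s root sta) w dom
      root-sta′ : ∀ q → toℕ q ≡ 0 → s₂ (leg j q) ≡ sta
      root-sta′ q q≡0 rewrite is-root q≡0 = round-claims s root {w} free-w
      rest-free′ : ∀ q → 1 ≤ toℕ q → s₂ (leg j q) ≡ free
      rest-free′ q 1≤q = trans (round-≢ s root w (not-root 1≤q) (λ e → w∉leg q (sym e))) (legs-free prog j q ≤-refl)

  jA jB : Fin (3 + ℓ′)
  jA = fromℕ< {suc ℓ′} (s≤s (s≤s (n≤1+n ℓ′)))
  jB = fromℕ< {2 + ℓ′} ≤-refl

  toℕ-jA : toℕ jA ≡ suc ℓ′
  toℕ-jA = toℕ-fromℕ< (s≤s (s≤s (n≤1+n ℓ′)))

  toℕ-jB : toℕ jB ≡ 2 + ℓ′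
  toℕ-jB = toℕ-fromℕ< {2 + ℓ′} ≤-refl

  legs-trichotomy : ∀ j → toℕ j < suc ℓ′ ⊎ j ≡ jA ⊎ j ≡ jB
  legs-trichotomy j with <-cmp (toℕ j) (suc ℓ′)
  ... | tri< j<1+ℓ′ _ _ = inj₁ j<1+ℓ′
  ... | tri≈ _ j≡1+ℓ′ _ = inj₂ (inj₁ (toℕ-injective (trans j≡1+ℓ′ (sym toℕ-jA))))
  ... | tri> _ _ j>1+ℓ′ = inj₂ (inj₂ (toℕ-injective (trans (≤-antisym (≤-pred (toℕ<n j)) j>1+ℓ′) (sym toℕ-jB))))

  A B N : ℕ
  A = n jA
  B = n jB
  N = A + B + 1

  -- The path through the last two legs: index p < A is leg jA (A - 1 - p),
  -- index A is the center and index A + 1 + q is leg jB q.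
  beyondCenter : ℕ → SV
  beyondCenter zero = center
  beyondCenter (suc q) = legVertex jB q

  pathVertex : ℕ → SV
  pathVertex p with p <? A
  ... | yes _ = legVertex jA (A ∸ suc p)
  ... | no _ = beyondCenter (p ∸ A)

  data PathIndex : ℕ → Set where
    onA      : (f : Fin A) → PathIndex (A ∸ suc (toℕ f))
    atCenter : PathIndex A
    onB      : (f : Fin B) → PathIndex (suc (A + toℕ f))

  vertexAt : ∀ {p} → PathIndex p → SV
  vertexAt (onA f) = leg jA f
  vertexAt atCenter = center
  vertexAt (onB f) = leg jB f

  N≡1+A+B : N ≡ suc (A + B)
  N≡1+A+B = +-comm (A + B) 1

  index-< : ∀ {p} → PathIndex p → p < N
  index-< (onA f) = <-trans (m∸1+n<m (toℕ<n f)) (index-< atCenter)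
  index-< atCenter = subst (A <_) (sym N≡1+A+B) (s≤s (m≤m+n A B))
  index-< (onB f) = subst (suc (A + toℕ f) <_) (sym N≡1+A+B) (s≤s (+-monoʳ-< A (toℕ<n f)))

  pathIndex : ∀ {p} → p < N → PathIndex p
  pathIndex {p} p<N with <-cmp p A
  ... | tri< p<A _ _ =
    subst PathIndex (trans (cong (λ x → A ∸ suc x) (toℕ-fromℕ< (m∸1+n<m p<A))) (m∸1+[m∸1+n]≡n p<A))
      (onA (fromℕ< (m∸1+n<m p<A)))
  ... | tri≈ _ refl _ = atCenter
  ... | tri> _ _ A<p =
    subst PathIndex (trans (cong (λ x → suc (A + x)) (toℕ-fromℕ< q<B)) (m+[n∸m]≡n A<p)) (onB (fromℕ< q<B))
    where
    q<B : p ∸ suc A < B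
    q<B = +-cancelˡ-< (suc A) _ B (subst (_< suc (A + B)) (sym (m+[n∸m]≡n A<p)) (subst (p <_) N≡1+A+B p<N))

  pathVertex-at : ∀ {p} (x : PathIndex p) → pathVertex p ≡ vertexAt x
  pathVertex-at (onA f) with A ∸ suc (toℕ f) <? A
  ... | yes _ = trans (cong (legVertex jA) (m∸1+[m∸1+n]≡n (toℕ<n f))) (legVertex-toℕ jA f)
  ... | no ≮A = contradiction (m∸1+n<m (toℕ<n f)) ≮A
  pathVertex-at atCenter with A <? A
  ... | yes A<A = contradiction A<A (<-irrefl refl)
  ... | no _ = cong beyondCenter (n∸n≡0 A)
  pathVertex-at (onB f) with suc (A + toℕ f) <? A
  ... | yes <A = contradiction (<-trans (s≤s (m≤m+n A (toℕ f))) <A) (<-irrefl refl)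
  ... | no _ = trans (cong beyondCenter (trans (+-∸-assoc 1 (m≤m+n A (toℕ f))) (cong suc (m+n∸m≡n A (toℕ f)))))
                     (legVertex-toℕ jB f)

  pathIndexOf : SV → ℕ
  pathIndexOf center = A
  pathIndexOf (leg j q) with toℕ j ≟ suc ℓ′
  ... | yes _ = A ∸ suc (toℕ q)
  ... | no _ = suc (A + toℕ q)

  pathIndexOf-at : ∀ {p} (x : PathIndex p) → pathIndexOf (vertexAt x) ≡ p
  pathIndexOf-at (onA f) with toℕ jA ≟ suc ℓ′
  ... | yes _ = refl
  ... | no jA≢ = contradiction toℕ-jA jA≢
  pathIndexOf-at atCenter = refl
  pathIndexOf-at (onB f) with toℕ jB ≟ suc ℓ′
  ... | yes jB≡ = contradiction (trans (sym toℕ-jB) jB≡) (1+n≢n)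
  ... | no _ = refl

  path-segment : ∀ {s} → Progress (suc ℓ′) s → Segment s 0 N pathVertex
  path-segment {s} prog = record
    { unclaimed = λ _ p<N → let x = pathIndex p<N in trans (cong s (pathVertex-at x)) (free-at x)
    ; injective = λ _ p<N _ p′<N e → let x = pathIndex p<N ; y = pathIndex p′<N in
        trans (sym (pathIndexOf-at x))
          (trans (cong pathIndexOf (trans (sym (pathVertex-at x)) (trans e (pathVertex-at y)))) (pathIndexOf-at y))
    ; closed = λ _ p<N {w} w∈N → let x = pathIndex p<N in near x (subst (λ v → InN v w) (pathVertex-at x) w∈N)
    }
    where
    free-at : ∀ {p} (x : PathIndex p) → s (vertexAt x) ≡ free
    free-at (onA f) = legs-free prog jA f (≤-reflexive (sym toℕ-jA))
    free-at atCenter = center-free prog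
    free-at (onB f) = legs-free prog jB f (subst (suc ℓ′ ≤_) (sym toℕ-jB) (n≤1+n _))

    Near′ : ℕ → SV → Set
    Near′ = Near s 0 N pathVertex

    here : ∀ {p} (x : PathIndex p) → Near′ p (vertexAt x)
    here x = inj₂ (inj₁ (sym (pathVertex-at x)))

    next : ∀ {p q} (y : PathIndex q) → q ≡ suc p → Near′ p (vertexAt y)
    next y refl = inj₂ (inj₂ (inj₁ (index-< y , sym (pathVertex-at y))))

    prev : ∀ {p q} (y : PathIndex q) → suc q ≡ p → Near′ p (vertexAt y)
    prev y 1+q≡p = inj₂ (inj₂ (inj₂ (_ , z≤n , 1+q≡p , sym (pathVertex-at y))))

    near : ∀ {p w} (x : PathIndex p) → InN (vertexAt x) w → Near′ p w
    near x (inj₁ refl) = here x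
    near (onA f) (inj₂ (l-c _ _ f≡0)) =
      next atCenter (sym (trans (suc[m∸1+n]≡m∸n (toℕ<n f)) (cong (A ∸_) f≡0)))
    near (onA f) (inj₂ (l-l⁺ _ _ f′ 1+f≡f′)) =
      prev (onA f′) (trans (suc[m∸1+n]≡m∸n (toℕ<n f′)) (cong (A ∸_) (sym 1+f≡f′)))
    near (onA f) (inj₂ (l-l⁻ _ _ f′ f≡1+f′)) =
      next (onA f′) (sym (trans (suc[m∸1+n]≡m∸n (toℕ<n f)) (cong (A ∸_) f≡1+f′)))
    near atCenter (inj₂ (c-l j q q≡0)) with legs-trichotomy j
    ... | inj₁ j<1+ℓ′ = inj₁ (roots-sta prog j q j<1+ℓ′ q≡0)
    ... | inj₂ (inj₁ refl) = prev (onA q) (trans (suc[m∸1+n]≡m∸n (toℕ<n q)) (cong (A ∸_) q≡0))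
    ... | inj₂ (inj₂ refl) = next (onB q) (cong suc (trans (cong (A +_) q≡0) (+-identityʳ A)))
    near (onB f) (inj₂ (l-c _ _ f≡0)) = prev atCenter (cong suc (sym (trans (cong (A +_) f≡0) (+-identityʳ A))))
    near (onB f) (inj₂ (l-l⁺ _ _ f′ 1+f≡f′)) = next (onB f′) (cong suc (trans (cong (A +_) (sym 1+f≡f′)) (+-suc A (toℕ f))))
    near (onB f) (inj₂ (l-l⁻ _ _ f′ f≡1+f′)) =
      prev (onB f′) (cong suc (trans (sym (+-suc A (toℕ f′))) (cong (A +_) (sym f≡1+f′))))

  path-win : ∀ {s k} → Progress (suc ℓ′) s → ⌈log₂ N ⌉ ≤ k → SWin k s
  path-win {s} {k} prog log≤k =
    SWin-mono s (subst (_≤ k) log≡ log≤k)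
      (Segment-win-log m (subst (λ h → Segment s 0 h pathVertex) N≡ (path-segment prog)))
    where
    a = proj₁ (half jA)
    b = proj₁ (half jB)
    m′ = suc (a + b)
    m = suc m′
    N≡ : N ≡ suc (m + m)
    N≡ = trans (cong₂ (λ x y → x + y + 1) (proj₂ (half jA)) (proj₂ (half jB))) (two-legs-length a b)
    log≡ : ⌈log₂ N ⌉ ≡ suc ⌈log₂ (suc m) ⌉
    log≡ = trans (cong ⌈log₂_⌉ N≡) (⌈log₂[3+2n]⌉≡1+⌈log₂[2+n]⌉ m′)

  module _ (K : ℕ) (legs-fit : ∀ j → toℕ j < suc ℓ′ → suc (toℕ j) + ⌈log₂ (n j) ⌉ ≤ K)
           (path-fit : suc ℓ′ + ⌈log₂ N ⌉ ≤ K) where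

    -- i roots are Staller's, r legs remain to be rooted and k + i = K.
    strategy : ∀ r {i k s} → r + i ≡ suc ℓ′ → k + i ≡ K → Progress i s → SWin k s
    strategy zero refl k+i≡K prog = path-win prog (m+n≤o+m⇒n≤o (suc ℓ′) (subst (_ ≤_) (sym k+i≡K) path-fit))
    strategy (suc r) {i} {k} {s} r+i≡ k+i≡K prog = go (m+n≤o+m⇒n≤o i leg-fits) k+i≡K
      where
      i<1+ℓ′ : i < suc ℓ′
      i<1+ℓ′ = subst (i <_) r+i≡ (s≤s (m≤n+m i r))
      i<ℓ : i < 3 + ℓ′
      i<ℓ = ≤-trans i<1+ℓ′ (m≤n+m (suc ℓ′) 2)
      j = fromℕ< i<ℓ
      toℕ-j : toℕ j ≡ i
      toℕ-j = toℕ-fromℕ< i<ℓ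
      leg-fits : i + suc ⌈log₂ (n j) ⌉ ≤ k + i
      leg-fits = subst₂ _≤_ (trans (cong (λ x → suc x + ⌈log₂ (n j) ⌉) toℕ-j) (sym (+-suc i _))) (sym k+i≡K)
                   (legs-fit j (subst (_< suc ℓ′) (sym toℕ-j) i<1+ℓ′))
      go : ∀ {k′} → suc ⌈log₂ (n j) ⌉ ≤ k′ → k′ + i ≡ K → SWin k′ s
      go {suc k′} (s≤s log≤k′) k′+i≡K =
        claim-root j toℕ-j prog log≤k′ (strategy r (trans (+-suc r i) r+i≡) (trans (+-suc k′ i) k′+i≡K))

    win : SWin K start
    win = strategy (suc ℓ′) (+-identityʳ _) (+-identityʳ K) record
      { center-free = refl ; legs-free = λ _ _ _ → refl ; roots-sta = λ _ _ () }

-- Dominator's pairing strategy on S(2, …, 2)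

∑ : ∀ k → (Fin k → ℕ) → ℕ
∑ zero f = 0
∑ (suc k) f = f Fin.zero + ∑ k (f ∘ Fin.suc)

∑-mono-≤ : ∀ k {f g : Fin k → ℕ} → (∀ j → f j ≤ g j) → ∑ k f ≤ ∑ k g
∑-mono-≤ zero f≤g = z≤n
∑-mono-≤ (suc k) f≤g = +-mono-≤ (f≤g Fin.zero) (∑-mono-≤ k (f≤g ∘ Fin.suc))

∑-mono-≤-but-one : ∀ k {f g : Fin k → ℕ} j₀ → (∀ j → ¬ j ≡ j₀ → f j ≤ g j) → f j₀ ≤ suc (g j₀) →
                   ∑ k f ≤ suc (∑ k g)
∑-mono-≤-but-one (suc k) Fin.zero f≤g f₀≤ = +-mono-≤ f₀≤ (∑-mono-≤ k (λ j → f≤g (Fin.suc j) λ ()))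
∑-mono-≤-but-one (suc k) {f} {g} (Fin.suc j₀) f≤g f₀≤ =
  subst (∑ (suc k) f ≤_) (+-suc (g Fin.zero) _)
    (+-mono-≤ (f≤g Fin.zero λ ())
              (∑-mono-≤-but-one k j₀ (λ j j≢j₀ → f≤g (Fin.suc j) (j≢j₀ ∘ Fin.suc-injective)) f₀≤))

∑-const : ∀ k c → ∑ k (λ _ → c) ≡ k * c
∑-const zero c = refl
∑-const (suc k) c = cong (c +_) (∑-const k c)

staCount : Owner → ℕ
staCount sta = 1
staCount free = 0
staCount dom = 0

staCount≤1 : ∀ o → staCount o ≤ 1
staCount≤1 sta = ≤-refl
staCount≤1 free = z≤n
staCount≤1 dom = z≤n

module LowerBound (ℓ : ℕ) where
  open Star ℓ (λ _ → 2)
  open Game (S ℓ (λ _ → 2))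
  open GameProperties (S ℓ (λ _ → 2))

  root tip : Fin ℓ → SV
  root j = leg j Fin.zero
  tip j = leg j (Fin.suc Fin.zero)

  data Partners : SV → SV → Set where
    root-tip : ∀ j → Partners (root j) (tip j)
    tip-root : ∀ j → Partners (tip j) (root j)

  Paired : Position → Set
  Paired s = ∀ {x y} → Partners x y → s x ≡ sta → s y ≡ dom

  Partners-sym : ∀ {x y} → Partners x y → Partners y x
  Partners-sym (root-tip j) = tip-root j
  Partners-sym (tip-root j) = root-tip j

  Partners-≢ : ∀ {x y} → Partners x y → ¬ x ≡ y
  Partners-≢ (root-tip j) ()
  Partners-≢ (tip-root j) ()

  partners-not-both : ∀ {s v x y} → Paired s → s v ≡ free → Partners x y →
                      set s v sta x ≡ sta → set s v sta y ≡ sta → ⊥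
  partners-not-both {s} {v} paired free-v xy s₁x≡sta s₁y≡sta
    with set-sta-origin s v s₁x≡sta | set-sta-origin s v s₁y≡sta
  ... | inj₁ sx≡sta | inj₁ sy≡sta = dom≢sta (trans (sym (paired xy sx≡sta)) sy≡sta)
  ... | inj₁ sx≡sta | inj₂ refl = free≢dom (trans (sym free-v) (paired xy sx≡sta))
  ... | inj₂ refl | inj₁ sy≡sta = free≢dom (trans (sym free-v) (paired (Partners-sym xy) sy≡sta))
  ... | inj₂ refl | inj₂ y≡x = Partners-≢ xy (sym y≡x)

  centerNbhd : Fin (suc ℓ) → SV
  centerNbhd Fin.zero = center
  centerNbhd (Fin.suc j) = root j

  nbhdIndex : SV → Fin (suc ℓ)
  nbhdIndex center = Fin.zero
  nbhdIndex (leg j _) = Fin.suc j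

  centerNbhd-≢ : ∀ {k v} → ¬ k ≡ nbhdIndex v → ¬ centerNbhd k ≡ v
  centerNbhd-≢ {Fin.zero} k≢ refl = k≢ refl
  centerNbhd-≢ {Fin.suc j} k≢ refl = k≢ refl

  claimedAtCenter : Position → ℕ
  claimedAtCenter s = ∑ (suc ℓ) (λ k → staCount (s (centerNbhd k)))

  claimedAtCenter-sta : ∀ s v → claimedAtCenter (set s v sta) ≤ suc (claimedAtCenter s)
  claimedAtCenter-sta s v = ∑-mono-≤-but-one (suc ℓ) (nbhdIndex v)
    (λ k k≢ → ≤-reflexive (cong staCount (set-≢ s v sta (centerNbhd-≢ k≢))))
    (≤-trans (staCount≤1 _) (s≤s z≤n))

  claimedAtCenter-dom : ∀ s w → claimedAtCenter (set s w dom) ≤ claimedAtCenter s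
  claimedAtCenter-dom s w = ∑-mono-≤ (suc ℓ) λ k → dom-only-lowers (centerNbhd k)
    where
    dom-only-lowers : ∀ x → staCount (set s w dom x) ≤ staCount (s x)
    dom-only-lowers x with x ≟SV w
    ... | yes _ = z≤n
    ... | no _ = ≤-refl

  won-only-at-center : ∀ {s v} → Paired s → s v ≡ free → StallerWon (set s v sta) →
                       suc ℓ ≤ claimedAtCenter (set s v sta)
  won-only-at-center {s} {v} paired free-v (center , all-sta) = begin
    suc ℓ                                ≡⟨ sym (trans (∑-const (suc ℓ) 1) (*-identityʳ (suc ℓ))) ⟩
    ∑ (suc ℓ) (λ _ → 1)                  ≤⟨ ∑-mono-≤ (suc ℓ) (λ k → ≤-reflexive (cong staCount (sym (claimed k)))) ⟩
    claimedAtCenter (set s v sta)        ∎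
    where
    open ≤-Reasoning
    claimed : ∀ k → set s v sta (centerNbhd k) ≡ sta
    claimed Fin.zero = all-sta _ (inj₁ refl)
    claimed (Fin.suc j) = all-sta _ (inj₂ (c-l j Fin.zero refl))
  won-only-at-center paired free-v (leg j Fin.zero , all-sta) =
    ⊥-elim (partners-not-both paired free-v (root-tip j) (all-sta _ (inj₁ refl)) (all-sta _ (inj₂ (l-l⁺ j _ _ refl))))
  won-only-at-center paired free-v (leg j (Fin.suc Fin.zero) , all-sta) =
    ⊥-elim (partners-not-both paired free-v (tip-root j) (all-sta _ (inj₁ refl)) (all-sta _ (inj₂ (l-l⁻ j _ _ refl))))

  Partners-unique : ∀ {v y y′} → Partners v y → Partners v y′ → y ≡ y′
  Partners-unique (root-tip j) (root-tip .j) = refl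
  Partners-unique (tip-root j) (tip-root .j) = refl

  partner? : ∀ v → (∃ λ y → Partners v y) ⊎ (∀ {y} → ¬ Partners v y)
  partner? center = inj₂ λ ()
  partner? (leg j Fin.zero) = inj₁ (tip j , root-tip j)
  partner? (leg j (Fin.suc Fin.zero)) = inj₁ (root j , tip-root j)

  reply : ∀ s v {w₀} → set s v sta w₀ ≡ free →
          ∃ λ w → set s v sta w ≡ free × (∀ {y} → Partners v y → s y ≡ free → w ≡ y)
  reply s v {w₀} free-w₀ with partner? v
  ... | inj₂ no-partner = w₀ , free-w₀ , λ vy → ⊥-elim (no-partner vy)
  ... | inj₁ (y₀ , vy₀) with isFree? (s y₀)
  ...   | yes sy₀≡free = y₀ , trans (set-≢ s v sta (Partners-≢ vy₀ ∘ sym)) sy₀≡free , λ vy _ → Partners-unique vy₀ vy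
  ...   | no sy₀≢free = w₀ , free-w₀ ,
          λ vy sy≡free → ⊥-elim (sy₀≢free (subst (λ y → s y ≡ free) (Partners-unique vy vy₀) sy≡free))

  Paired-step : ∀ {s v w} → Paired s → s v ≡ free → set s v sta w ≡ free →
                (∀ {y} → Partners v y → s y ≡ free → w ≡ y) → Paired (set (set s v sta) w dom)
  Paired-step {s} {v} {w} paired free-v free-w answers {x} {y} xy s₂x≡sta
    with set-sta-origin s v {x} (set-dom-sta-origin (set s v sta) w {x} s₂x≡sta)
  ... | inj₁ sx≡sta = keeps-dom (paired xy sx≡sta)
    where
    keeps-dom : ∀ {z} → s z ≡ dom → set (set s v sta) w dom z ≡ dom
    keeps-dom {z} sz≡dom = set-dom-keeps-dom (set s v sta) w {z}
      (trans (set-≢ s v sta {z} λ { refl → free≢dom (trans (sym free-v) sz≡dom) }) sz≡dom)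
  ... | inj₂ refl with s y in sy≡
  ...   | free = subst (λ z → set (set s v sta) w dom z ≡ dom) (answers xy sy≡) (set-≡ (set s v sta) w dom)
  ...   | sta = ⊥-elim (free≢dom (trans (sym free-v) (paired (Partners-sym xy) sy≡)))
  ...   | dom = set-dom-keeps-dom (set s v sta) w {y} (trans (set-≢ s v sta {y} (Partners-≢ xy ∘ sym)) sy≡)

  lower : ∀ m s → Paired s → SWin m s → suc ℓ ≤ m + claimedAtCenter s
  lower (suc m) s paired (v , free-v , inj₁ won) = begin
    suc ℓ                              ≤⟨ won-only-at-center paired free-v won ⟩
    claimedAtCenter (set s v sta)      ≤⟨ claimedAtCenter-sta s v ⟩
    suc (claimedAtCenter s)            ≤⟨ s≤s (m≤n+m _ m) ⟩
    suc m + claimedAtCenter s          ∎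
    where open ≤-Reasoning
  lower (suc m) s paired (v , free-v , inj₂ ((w₀ , free-w₀) , respond)) with reply s v {w₀} free-w₀
  ... | w , free-w , answers = begin
    suc ℓ                                          ≤⟨ lower m _ (Paired-step paired free-v free-w answers) (respond w free-w) ⟩
    m + claimedAtCenter (set (set s v sta) w dom)  ≤⟨ +-monoʳ-≤ m (≤-trans (claimedAtCenter-dom _ w) (claimedAtCenter-sta s v)) ⟩
    m + suc (claimedAtCenter s)                    ≡⟨ +-suc m _ ⟩
    suc m + claimedAtCenter s                      ∎
    where open ≤-Reasoning

  lower-bound : ∀ m → γSMB'≤ (S ℓ (λ _ → 2)) m → suc ℓ ≤ m
  lower-bound m win = subst (suc ℓ ≤_) (trans (cong (m +_) (trans (∑-const (suc ℓ) 0) (*-zeroʳ (suc ℓ)))) (+-identityʳ m))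
    (lower m start (λ _ ()) win)

upper-bound : (ℓ : ℕ) → 3 ≤ ℓ → (n : Fin ℓ → ℕ) → Admissible ℓ n → γSMB'≤ (S ℓ n) (bound ℓ n)
upper-bound 1 (s≤s ())
upper-bound 2 (s≤s (s≤s ()))
-- The legs need not be ordered by length.
upper-bound ℓ@(suc (suc (suc ℓ′))) _ n (positive , even , _) = win (bound ℓ n) legs-fit path-fit
  where
  open UpperBound ℓ′ n (λ j → positive-even (positive j) (even j))
  legs-fit : ∀ j → toℕ j < suc ℓ′ → suc (toℕ j) + ⌈log₂ (n j) ⌉ ≤ bound ℓ n
  legs-fit j j<1+ℓ′ =
    subst (λ x → suc (toℕ j) + ⌈log₂ x ⌉ ≤ bound ℓ n) (at-toℕ ℓ n j) (legTerm≤bound ℓ n j<1+ℓ′)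
  at-index : ∀ {i} j → toℕ j ≡ i → at ℓ n i ≡ n j
  at-index j refl = at-toℕ ℓ n j
  path-fit : suc ℓ′ + ⌈log₂ (n jA + n jB + 1) ⌉ ≤ bound ℓ n
  path-fit = subst₂ (λ x y → suc ℓ′ + ⌈log₂ (x + y + 1) ⌉ ≤ bound ℓ n) (at-index jA toℕ-jA) (at-index jB toℕ-jB)
    (pathTerm≤bound ℓ n)

bound-all-two : ∀ ℓ′ → bound (3 + ℓ′) (λ _ → 2) ≤ 4 + ℓ′
bound-all-two ℓ′ = bound≤ (3 + ℓ′) (λ _ → 2)
  (≤-trans (+-monoʳ-≤ (suc ℓ′) (⌈log₂⌉-mono-≤ {n = 5}
             (+-monoˡ-≤ 1 (+-mono-≤ (at-const≤ (3 + ℓ′) 2 (suc ℓ′)) (at-const≤ (3 + ℓ′) 2 (2 + ℓ′))))))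
           (≤-reflexive (+-comm (suc ℓ′) 3)))
  (λ {i} i<1+ℓ′ → ≤-trans (+-mono-≤ i<1+ℓ′ (⌈log₂⌉-mono-≤ {n = 2} (at-const≤ (3 + ℓ′) 2 i)))
                          (≤-trans (≤-reflexive (+-comm (suc ℓ′) 1)) (m≤n+m _ 2)))

sharp : (ℓ : ℕ) → 3 ≤ ℓ → Σ (Fin ℓ → ℕ) λ n → Admissible ℓ n × γSMB'≡ (S ℓ n) (bound ℓ n)
sharp 1 (s≤s ())
sharp 2 (s≤s (s≤s ()))
sharp ℓ@(suc (suc (suc ℓ′))) 3≤ℓ =
  (λ _ → 2) , all-two , upper-bound ℓ 3≤ℓ _ all-two ,
  λ m win → ≤-trans (bound-all-two ℓ′) (LowerBound.lower-bound ℓ m win)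
  where
  all-two : Admissible ℓ (λ _ → 2)
  all-two = (λ _ → s≤s z≤n) , (λ _ → 1 , refl) , (λ _ _ _ → ≤-refl)

proposition23 : ((ℓ : ℕ) → 3 ≤ ℓ → (n : Fin ℓ → ℕ) → Admissible ℓ n →
    γSMB'≤ (S ℓ n) (bound ℓ n))
    ×
    ((ℓ : ℕ) → 3 ≤ ℓ → Σ (Fin ℓ → ℕ) λ n →
    Admissible ℓ n × γSMB'≡ (S ℓ n) (bound ℓ n))
proposition23 = upper-bound , sharp
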